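{- In the chain graph of $\sigma\in S_n$ for disjoint $k$-sets $A,B$ with $\sigma_{\langle A\rangle}=\sigma_{\langle B\rangle}$, an edge of a chain $C$ cannot be cut by another point of $C$.
   Context: $S_n$ is the set of permutations of $[n]$. Points of $\sigma$ are $(i,\sigma(i))$, identified with positions $i$ and ordered left to right. For $A\subset[n]$, $\sigma_{\langle A\rangle}$ is the permutation in the same relative order as the word obtained by deleting the entries at positions in $A$; if $[n]\setminus A=\{i_1<\dots<i_r\}$, the $i_j$th entry of $\sigma$ fulfills the $j$th entry of $\sigma_{\langle A\rangle}$. For disjoint $k$-sets $A,B$ with $\sigma_{\langle A\rangle}=\sigma_{\langle B\rangle}$, the chain graph has vertex set the points of $\sigma$; for each $i\in[n-k]$ an edge joins the point fulfilling the $i$th entry of $\sigma_{\langle A\rangle}$ and the point fulfilling the $i$th entry of $\sigma_{\langle B\rangle}$ when these differ (when they coincide the point is a fixed point). The chains are the connected components of the chain graph having at least one edge (each is a path). For distinct points $p,p'$, the span of $p,p'$ is the set of points whose position lies strictly between those of $p,p'$ or whose value lies strictly between $\sigma(p),\sigma(p')$. A point $q$ in the span cuts $pp'$ from the left/right if its position is left/right of both $p,p'$, and from below/above if its value is less/greater than both $\sigma(p),\sigma(p')$; a point whose position and value both lie strictly between those of $p,p'$ cuts $pp'$ both horizontally and vertically. A point of the span is said to cut $pp'$. -}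

module Defs where

open import Data.Nat using (ℕ; zero; suc; _+_; _<_)
open import Data.Fin using (Fin; toℕ) renaming (zero to fzero; suc to fsuc)
open import Data.Fin.Subset using (Subset; _∈_; _∉_; ∣_∣)
open import Data.Fin.Permutation using (Permutation′; _⟨$⟩ʳ_)
open import Data.Bool using (Bool; true; false; not; _∧_)
open import Data.Vec using (lookup)
open import Data.Product using (_×_; ∃)
open import Data.Sum using (_⊎_)
open import Data.Empty using (⊥)
open import Relation.Binary.PropositionalEquality using (_≡_; _≢_)
open import Relation.Binary.Construct.Closure.ReflexiveTransitive using (Star)

boolToℕ : Bool → ℕ
boolToℕ true  = 1
boolToℕ false = 0

count : (n : ℕ) → (Fin n → Bool) → ℕ
count zero    P = 0
count (suc n) P = boolToℕ (P fzero) + count n (λ q → P (fsuc q))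

module _ {n : ℕ} where
  notIn : Subset n → Fin n → Bool
  notIn A q = not (lookup A q)

  _<ᵇ_ : Fin n → Fin n → Bool
  a <ᵇ b = Data.Nat._<ᵇ_ (toℕ a) (toℕ b)

  val : Permutation′ n → Fin n → ℕ
  val σ p = toℕ (σ ⟨$⟩ʳ p)

  -- Fulfils A i p : position p (0-indexed) is not deleted by A and is the
  -- i-th (0-indexed) surviving position, i.e. the point p fulfils the
  -- (i+1)-st entry of σ_⟨A⟩.
  Fulfils : Subset n → ℕ → Fin n → Set
  Fulfils A i p = p ∉ A × count n (λ q → notIn A q ∧ (q <ᵇ p)) ≡ i

  -- standardized value of the entry at (surviving) position p in σ_⟨A⟩:
  -- number of surviving entries with smaller value (0-indexed).
  -- So σ_⟨A⟩ (i) = stdVal σ A p + 1 where Fulfils A i p.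
  stdVal : Permutation′ n → Subset n → Fin n → ℕ
  stdVal σ A p = count n (λ q → notIn A q ∧ ((σ ⟨$⟩ʳ q) <ᵇ (σ ⟨$⟩ʳ p)))

  SamePattern : Permutation′ n → Subset n → Subset n → Set
  SamePattern σ A B = ∀ (i : ℕ) (p p′ : Fin n) →
    Fulfils A i p → Fulfils B i p′ → stdVal σ A p ≡ stdVal σ B p′

  ChainEdge : Subset n → Subset n → Fin n → Fin n → Set
  ChainEdge A B p p′ = p ≢ p′ × ∃ λ i →
    (Fulfils A i p × Fulfils B i p′) ⊎ (Fulfils A i p′ × Fulfils B i p)

  SameChain : Subset n → Subset n → Fin n → Fin n → Set
  SameChain A B = Star (ChainEdge A B)

StrictlyBetween : ℕ → ℕ → ℕ → Set
StrictlyBetween a b c = (a < c × c < b) ⊎ (b < c × c < a)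

Cuts : {n : ℕ} → Permutation′ n → Fin n → Fin n → Fin n → Set
Cuts σ q p p′ = StrictlyBetween (toℕ p) (toℕ p′) (toℕ q)
              ⊎ StrictlyBetween (val σ p) (val σ p′) (val σ q)

module Submission where

-- Call x ↦ y ("x is matched to y") when x and y fulfil the same
-- entry of σ_⟨A⟩ and σ_⟨B⟩ respectively.  Then ↦ is a partial bijection
-- on the points, the chain graph is its symmetric closure, and a chain is
-- an orbit of ↦.  Moreover ↦ is strictly increasing both in position
-- (it preserves the index among surviving positions) and in value (by
-- σ_⟨A⟩ = σ_⟨B⟩ it preserves the rank among surviving values).  Along the
-- orbit of an increasing partial bijection an ascent p ↦ p′ forces all
-- later points to lie at or above p′ and all earlier points at or below p,
-- so no point of the orbit lies strictly between p and p′.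

open import Defs
open import Data.Nat using (ℕ; zero; suc; _<_; _≤_; z≤n)
open import Data.Nat.Properties
open import Data.Fin using (Fin; toℕ) renaming (zero to fzero; suc to fsuc)
open import Data.Fin.Properties using (toℕ-injective)
open import Data.Fin.Subset using (Subset; _∈_; _∉_; ∣_∣)
open import Data.Fin.Permutation using (Permutation′; _⟨$⟩ˡ_; inverseˡ)
open import Data.Bool using (Bool; true; false; _∧_; T)
open import Data.Bool.Properties using (T-∧)
open import Data.Vec using (lookup)
open import Data.Vec.Properties using (lookup⇒[]=)
open import Data.Product using (_×_; ∃; _,_; proj₂)
open import Data.Sum using (_⊎_; inj₁; inj₂; [_,_]′)
open import Data.Empty using (⊥; ⊥-elim)
open import Function.Base using (flip)
open import Function.Bundles using (Equivalence)
open import Function.Definitions using (Injective)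
open import Relation.Nullary using (¬_)
open import Relation.Binary using (tri<; tri≈; tri>)
open import Relation.Binary.PropositionalEquality
  using (_≡_; _≢_; refl; sym; trans; cong; subst₂)
open import Relation.Binary.Construct.Closure.ReflexiveTransitive
  using (Star; ε; _◅_; _◅◅_)
  renaming (map to Star-map)
open import Relation.Binary.Construct.Closure.Symmetric using (SymClosure; fwd; bwd)

boolToℕ-≤ : ∀ a b → (T a → T b) → boolToℕ a ≤ boolToℕ b
boolToℕ-≤ false b     _   = z≤n
boolToℕ-≤ true  true  _   = ≤-refl
boolToℕ-≤ true  false a⇒b = ⊥-elim (a⇒b _)

boolToℕ-< : ∀ a b → ¬ T a → T b → boolToℕ a < boolToℕ b
boolToℕ-< false true  _  _  = ≤-refl
boolToℕ-< true  _     ¬a _  = ⊥-elim (¬a _)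

count-≤ : ∀ n {P Q : Fin n → Bool} → (∀ q → T (P q) → T (Q q)) →
          count n P ≤ count n Q
count-≤ zero    P⇒Q = z≤n
count-≤ (suc n) {P} {Q} P⇒Q =
  +-mono-≤ (boolToℕ-≤ (P fzero) (Q fzero) (P⇒Q fzero)) (count-≤ n (λ q → P⇒Q (fsuc q)))

count-< : ∀ n {P Q : Fin n → Bool} → (∀ q → T (P q) → T (Q q)) →
          (z : Fin n) → ¬ T (P z) → T (Q z) → count n P < count n Q
count-< (suc n) {P} {Q} P⇒Q fzero ¬Pz Qz =
  +-mono-<-≤ (boolToℕ-< (P fzero) (Q fzero) ¬Pz Qz) (count-≤ n (λ q → P⇒Q (fsuc q)))
count-< (suc n) {P} {Q} P⇒Q (fsuc z) ¬Pz Qz =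
  +-mono-≤-< (boolToℕ-≤ (P fzero) (Q fzero) (P⇒Q fzero)) (count-< n (λ q → P⇒Q (fsuc q)) z ¬Pz Qz)

∉⇒notIn : ∀ {n} (A : Subset n) {x : Fin n} → x ∉ A → T (notIn A x)
∉⇒notIn A {x} x∉A with lookup A x in eq
... | true  = x∉A (lookup⇒[]= x A eq)
... | false = _

-- Ranks with respect to an order given by ord: rank A x is the number of
-- points outside A strictly below x.  For ord = toℕ this is the index used
-- by Fulfils, for ord = val σ it is stdVal σ.
module Rank {n : ℕ} (ord : Fin n → ℕ) where

  Below : Subset n → Fin n → Fin n → Bool
  Below A x q = notIn A q ∧ Data.Nat._<ᵇ_ (ord q) (ord x)

  rank : Subset n → Fin n → ℕ
  rank A x = count n (Below A x)

  below⇒< : ∀ {A x q} → T (Below A x q) → ord q < ord x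
  below⇒< {A} {x} {q} b =
    <ᵇ⇒< (ord q) (ord x) (proj₂ (Equivalence.to T-∧ b))

  <⇒below : ∀ {A x q} → q ∉ A → ord q < ord x → T (Below A x q)
  <⇒below {A} q∉A q<x = Equivalence.from T-∧ (∉⇒notIn A q∉A , <⇒<ᵇ q<x)

  below-trans : ∀ {A x y} q → ord x < ord y → T (Below A x q) → T (Below A y q)
  below-trans {A} {x} {y} q x<y b =
    let (q∉ , _) = Equivalence.to T-∧ b
    in Equivalence.from T-∧ (q∉ , <⇒<ᵇ (<-trans (below⇒< {A} {x} {q} b) x<y))

  rank-< : ∀ A {x y} → x ∉ A → ord x < ord y → rank A x < rank A y
  rank-< A {x} {y} x∉A x<y =
    count-< n (λ q → below-trans {A} q x<y) x
      (λ b → <-irrefl refl (below⇒< {A} {x} {x} b)) (<⇒below x∉A x<y)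

  rank-cong : ∀ A {x y} → ord x ≡ ord y → rank A x ≡ rank A y
  rank-cong A {x} eq = cong (λ v → count n (λ q → notIn A q ∧ Data.Nat._<ᵇ_ (ord q) v)) eq

  rank-reflects-< : ∀ A {x y} → y ∉ A → rank A x < rank A y → ord x < ord y
  rank-reflects-< A {x} {y} y∉A rx<ry with <-cmp (ord x) (ord y)
  ... | tri< x<y _ _ = x<y
  ... | tri≈ _ x=y _ = ⊥-elim (<-irrefl (rank-cong A x=y) rx<ry)
  ... | tri> _ _ y<x = ⊥-elim (<-asym rx<ry (rank-< A y∉A y<x))

  rank-injective : Injective _≡_ _≡_ ord → ∀ A {x y} → x ∉ A → y ∉ A →
                   rank A x ≡ rank A y → x ≡ y
  rank-injective ord-inj A {x} {y} x∉A y∉A rx=ry with <-cmp (ord x) (ord y)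
  ... | tri< x<y _ _ = ⊥-elim (<-irrefl rx=ry (rank-< A x∉A x<y))
  ... | tri≈ _ x=y _ = ord-inj x=y
  ... | tri> _ _ y<x = ⊥-elim (<-irrefl (sym rx=ry) (rank-< A y∉A y<x))

module PartialBijection {X : Set} (_↦_ : X → X → Set)
  (functional : ∀ {x y y′} → x ↦ y → x ↦ y′ → y ≡ y′)
  (injective  : ∀ {x x′ y} → x ↦ y → x′ ↦ y → x ≡ x′) where

  OnOrbit : X → X → Set
  OnOrbit p q = Star _↦_ p q ⊎ Star _↦_ q p

  drop-last : ∀ {p v w} → Star _↦_ p w → v ↦ w → p ≡ w ⊎ Star _↦_ p v
  drop-last ε _ = inj₁ refl
  drop-last (f ◅ s) g with drop-last s g
  ... | inj₂ s′   = inj₂ (f ◅ s′)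
  ... | inj₁ refl with injective f g
  ...   | refl = inj₂ ε

  orbit-step : ∀ {p w v} → OnOrbit p w → SymClosure _↦_ w v → OnOrbit p v
  orbit-step (inj₁ s) (fwd f) = inj₁ (s ◅◅ (f ◅ ε))
  orbit-step (inj₁ s) (bwd f) with drop-last s f
  ... | inj₁ refl = inj₂ (f ◅ ε)
  ... | inj₂ s′   = inj₁ s′
  orbit-step (inj₂ s) (bwd f) = inj₂ (f ◅ s)
  orbit-step (inj₂ ε) (fwd f) = inj₁ (f ◅ ε)
  orbit-step (inj₂ (g ◅ s)) (fwd f) with functional g f
  ... | refl = inj₂ s

  component⇒orbit : ∀ {p q} → Star (SymClosure _↦_) p q → OnOrbit p q
  component⇒orbit = extend (inj₁ ε)
    where
    extend : ∀ {p w q} → OnOrbit p w → Star (SymClosure _↦_) w q → OnOrbit p q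
    extend o ε       = o
    extend o (e ◅ s) = extend (orbit-step o e) s

record IncreasingMatching {X : Set} (ord : X → ℕ) : Set₁ where
  field
    _↦_        : X → X → Set
    functional : ∀ {x y y′} → x ↦ y → x ↦ y′ → y ≡ y′
    injective  : ∀ {x x′ y} → x ↦ y → x′ ↦ y → x ≡ x′
    increasing : ∀ {x y x′ y′} → x ↦ y → x′ ↦ y′ → ord x < ord x′ → ord y < ord y′

module Increasing {X : Set} {ord : X → ℕ} (ord-injective : Injective _≡_ _≡_ ord) where

  converse : IncreasingMatching ord → IncreasingMatching ord
  converse M = record
    { _↦_        = flip _↦_
    ; functional = injective
    ; injective  = functional
    ; increasing = reflects
    }
    where
    open IncreasingMatching M
    reflects : ∀ {x y x′ y′} → y ↦ x → y′ ↦ x′ → ord x < ord x′ → ord y < ord y′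
    reflects {x} {y} {x′} {y′} f f′ x<x′ with <-cmp (ord y) (ord y′)
    ... | tri< y<y′ _ _ = y<y′
    ... | tri≈ _ y=y′ _ with ord-injective y=y′
    ...   | refl = ⊥-elim (<-irrefl (cong ord (functional f f′)) x<x′)
    reflects f f′ x<x′ | tri> _ _ y′<y = ⊥-elim (<-asym x<x′ (increasing f′ f y′<y))

  converse-edge : ∀ {M : IncreasingMatching ord} {u v} →
    SymClosure (IncreasingMatching._↦_ M) u v →
    SymClosure (IncreasingMatching._↦_ (converse M)) u v
  converse-edge (fwd f) = bwd f
  converse-edge (bwd f) = fwd f

  module _ (M : IncreasingMatching ord) where
    open IncreasingMatching M
    open PartialBijection _↦_ functional injective

    Ascent : X → Set
    Ascent x = ∃ λ y → x ↦ y × ord x < ord y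

    predecessor-below : ∀ {w x} → w ↦ x → Ascent x → ord w < ord x
    predecessor-below {w} {x} g (y , f , x<y) with <-cmp (ord w) (ord x)
    ... | tri< w<x _ _ = w<x
    ... | tri≈ _ w=x _ with ord-injective w=x
    ...   | refl = ⊥-elim (<-irrefl (cong ord (functional g f)) x<y)
    predecessor-below g (y , f , x<y) | tri> _ _ x<w = ⊥-elim (<-asym x<y (increasing f g x<w))

    forward-above : ∀ {x y w} → x ↦ y → ord x < ord y → Star _↦_ y w → ord y ≤ ord w
    forward-above f x<y ε       = ≤-refl
    forward-above f x<y (g ◅ s) with increasing f g x<y
    ... | y<z = <⇒≤ (<-≤-trans y<z (forward-above g y<z s))

    backward-below : ∀ {w x} → Star _↦_ w x → Ascent x → Ascent w × ord w ≤ ord x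
    backward-below ε       a = a , ≤-refl
    backward-below (g ◅ s) a with backward-below s a
    ... | az , z≤x with predecessor-below g az
    ...   | w<z = (_ , g , w<z) , <⇒≤ (<-≤-trans w<z z≤x)

    ascent-not-cut : ∀ {p p′ q} → p ↦ p′ → ord p < ord p′ →
      Star (SymClosure _↦_) p q → ¬ (ord p < ord q × ord q < ord p′)
    ascent-not-cut f p<p′ chain (p<q , q<p′) with component⇒orbit chain
    ... | inj₁ ε       = <-irrefl refl p<q
    ... | inj₁ (g ◅ s) with functional f g
    ...   | refl = <-irrefl refl (<-≤-trans q<p′ (forward-above f p<p′ s))
    ascent-not-cut f p<p′ chain (p<q , q<p′) | inj₂ s =
      <-irrefl refl (<-≤-trans p<q (proj₂ (backward-below s (_ , f , p<p′))))

  edge-not-cut : (M : IncreasingMatching ord) → let open IncreasingMatching M in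
    ∀ {p p′ q} → p ↦ p′ → Star (SymClosure _↦_) p q →
    ¬ StrictlyBetween (ord p) (ord p′) (ord q)
  edge-not-cut M {p} {p′} f chain between with <-cmp (ord p) (ord p′) | between
  ... | tri< p<p′ _ _ | inj₁ inside = ascent-not-cut M f p<p′ chain inside
  ... | tri< p<p′ _ _ | inj₂ (p′<q , q<p) = <-asym p<p′ (<-trans p′<q q<p)
  ... | tri≈ _ p=p′ _ | inj₁ (p<q , q<p′) = <-asym p<q (subst₂ _<_ refl (sym p=p′) q<p′)
  ... | tri≈ _ p=p′ _ | inj₂ (p′<q , q<p) = <-asym p′<q (subst₂ _<_ refl p=p′ q<p)
  ... | tri> _ _ p′<p | inj₁ (p<q , q<p′) = <-asym p′<p (<-trans p<q q<p′)
  ... | tri> _ _ p′<p | inj₂ inside =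
    ascent-not-cut (converse M) f p′<p (Star-map (converse-edge {M = M}) (bwd f ◅ chain)) inside

  not-cut : (M : IncreasingMatching ord) → let open IncreasingMatching M in
    ∀ {p p′ q} → SymClosure _↦_ p p′ → Star (SymClosure _↦_) p q →
    ¬ StrictlyBetween (ord p) (ord p′) (ord q)
  not-cut M (fwd f) chain = edge-not-cut M f chain
  not-cut M (bwd f) chain = edge-not-cut (converse M) f (Star-map (converse-edge {M = M}) chain)

val-injective : ∀ {n} (σ : Permutation′ n) → Injective _≡_ _≡_ (val σ)
val-injective σ eq =
  trans (sym (inverseˡ σ)) (trans (cong (σ ⟨$⟩ˡ_) (toℕ-injective eq)) (inverseˡ σ))

module Matching {n : ℕ} (A B : Subset n) where
  open Rank

  Matched : Fin n → Fin n → Set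
  Matched x y = ∃ λ i → Fulfils A i x × Fulfils B i y

  chain-edge : ∀ {u v} → ChainEdge A B u v → SymClosure Matched u v
  chain-edge (_ , i , inj₁ (a , b)) = fwd (i , a , b)
  chain-edge (_ , i , inj₂ (a , b)) = bwd (i , a , b)

  -- a matching which preserves ranks is increasing for the ranking order
  -- (being a partial bijection only uses that it preserves indices)
  rank-preserving : (ord : Fin n → ℕ) →
    (∀ {x y} → Matched x y → rank ord A x ≡ rank ord B y) → IncreasingMatching ord
  rank-preserving ord preserves = record
    { _↦_        = Matched
    ; functional = λ { (i , (_ , ix) , (y∉ , iy)) (j , (_ , jx) , (y′∉ , jy′)) →
        rank-injective toℕ toℕ-injective B y∉ y′∉ (trans iy (trans (sym ix) (trans jx (sym jy′)))) }
    ; injective  = λ { (i , (x∉ , ix) , (_ , iy)) (j , (x′∉ , jx′) , (_ , jy)) →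
        rank-injective toℕ toℕ-injective A x∉ x′∉ (trans ix (trans (sym iy) (trans jy (sym jx′)))) }
    ; increasing = λ { m@(_ , (x∉ , _) , _) m′@(_ , _ , (y′∉ , _)) x<x′ →
        rank-reflects-< ord B y′∉
          (subst₂ _<_ (preserves m) (preserves m′) (rank-< ord A x∉ x<x′)) }
    }

  by-position : IncreasingMatching toℕ
  by-position = rank-preserving toℕ
    (λ { (i , (_ , ix) , (_ , iy)) → trans ix (sym iy) })

  by-value : (σ : Permutation′ n) → SamePattern σ A B → IncreasingMatching (val σ)
  by-value σ same = rank-preserving (val σ)
    (λ { (i , fx , fy) → same i _ _ fx fy })

corollary2p13 : (n k : ℕ) (σ : Permutation′ n) (A B : Subset n) →
    ∣ A ∣ ≡ k → ∣ B ∣ ≡ k → (∀ (p : Fin n) → p ∈ A → p ∈ B → ⊥) →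
    SamePattern σ A B →
    (p p′ q : Fin n) → ChainEdge A B p p′ → SameChain A B p q →
    q ≢ p → q ≢ p′ → ¬ Cuts σ q p p′
corollary2p13 n k σ A B _ _ _ same p p′ q edge chain _ _ =
  [ Increasing.not-cut toℕ-injective by-position matched-edge matched-chain
  , Increasing.not-cut (val-injective σ) (by-value σ same) matched-edge matched-chain ]′
  where
  open Matching A B
  matched-edge : SymClosure Matched p p′
  matched-edge = chain-edge edge
  matched-chain : Star (SymClosure Matched) p q
  matched-chain = Star-map chain-edge chain
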